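{- Let $m,n\geq 4$. Then \[ P(T,m\times n)=\bigcup_{i,j\in\{1,2,3\}}P_{i,j}(T,m\times n), \] and the nine sets $P_{i,j}(T,m\times n)$, $i,j\in\{1,2,3\}$, are non-empty and pairwise disjoint.
   Context: Work over the alphabet $\{0,1\}$ and regard patterns as binary matrices (rows from the top, columns from the left). The block substitution $\mu$ maps $0$ to the $3\times3$ matrix with rows $(1,0,1),(0,0,0),(1,0,1)$ and $1$ to the $3\times3$ matrix with rows $(0,1,0),(1,1,1),(0,1,0)$; it acts on an $m\times n$ binary matrix by replacing each entry by its $3\times3$ image block (giving a $3m\times3n$ matrix). Let $T_k=\mu^k(0)$; the squiral tiling $T$ is their limit, and $P(T,m\times n)=\bigcup_{k\ge0}P(T_k,m\times n)$, where $P(S,m\times n)$ is the set of $m\times n$ contiguous submatrices of $S$. For a finite pattern $S$, $S[r,c,m\times n]$ denotes the $m\times n$ submatrix of $S$ with upper-left corner at row $r$, column $c$. For $i,j\in\{1,2,3\}$, $P_{i,j}(T,m\times n):=\{\mu(x)[i,j,m\times n] : x\in P(T,m\times n)\}$. -}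

module Defs where

open import Data.Bool using (Bool; true; false)
open import Data.Nat using (ℕ; zero; suc; _+_; _*_)
open import Data.Fin using (Fin; toℕ)
open import Data.Fin.Patterns using (0F; 1F; 2F)
open import Data.Vec using (Vec; []; _∷_; lookup; tabulate; concat; map)
open import Data.Maybe using (Maybe; just; nothing; _>>=_)
open import Data.Product using (Σ; _×_; ∃; ∃-syntax)
open import Relation.Binary.PropositionalEquality using (_≡_)

-- Binary matrices: 0 = false, 1 = true. A matrix is a vector of rows.
Mat : ℕ → ℕ → Set
Mat m n = Vec (Vec Bool n) m

blockRow : Bool → Fin 3 → Vec Bool 3
blockRow false 0F = true ∷ false ∷ true ∷ []
blockRow false 1F = false ∷ false ∷ false ∷ []
blockRow false 2F = true ∷ false ∷ true ∷ []
blockRow true  0F = false ∷ true ∷ false ∷ []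
blockRow true  1F = true ∷ true ∷ true ∷ []
blockRow true  2F = false ∷ true ∷ false ∷ []

μ : ∀ {m n} → Mat m n → Mat (m * 3) (n * 3)
μ M = concat (map (λ row → tabulate (λ i → concat (map (λ b → blockRow b i) row))) M)

side : ℕ → ℕ
side zero = 1
side (suc k) = side k * 3

T : (k : ℕ) → Mat (side k) (side k)
T zero = (false ∷ []) ∷ []
T (suc k) = μ (T k)

at : ∀ {A : Set} {n} → Vec A n → ℕ → Maybe A
at [] _ = nothing
at (x ∷ xs) zero = just x
at (x ∷ xs) (suc i) = at xs i

atM : ∀ {M N} → Mat M N → ℕ → ℕ → Maybe Bool
atM S r c = at S r >>= λ row → at row c

-- IsSub S r c x : x is the m×n contiguous submatrix of S with upper-left
-- corner at (0-based) row r, column c, i.e. x = S[r+1, c+1, m×n] in the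
-- paper's 1-based notation (in particular it lies inside S).
IsSub : ∀ {M N m n} → Mat M N → ℕ → ℕ → Mat m n → Set
IsSub S r c x = ∀ i j → atM S (r + toℕ i) (c + toℕ j) ≡ just (lookup (lookup x i) j)

InP : ∀ {M N m n} → Mat M N → Mat m n → Set
InP S x = ∃[ r ] ∃[ c ] IsSub S r c x

InPT : ∀ {m n} → Mat m n → Set
InPT x = ∃[ k ] InP (T k) x

-- y ∈ P_{i,j}(T, m×n), where i,j ∈ {1,2,3} are represented by Fin 3
-- (0F ↦ 1, 1F ↦ 2, 2F ↦ 3): y = μ(x)[i,j,m×n] for some x ∈ P(T,m×n).
InPij : ∀ {m n} → Fin 3 → Fin 3 → Mat m n → Set
InPij {m} {n} i j y = ∃[ x ] (InPT {m} {n} x × IsSub (μ x) (toℕ i) (toℕ j) y)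

{-# OPTIONS --safe #-}
module Submission where

-- μ carries an occurrence of x in T_k at (r, c) to an occurrence of μ(x) in T_{k+1} at (3r, 3c),
-- which gives the inclusion of the P_{i,j}. Conversely, T_k sits in the centre of T_{k+1}, so an
-- occurrence of y in T_k is also one in T_{k+2} = μ(T_{k+1}), now far from the border. Writing its
-- position as (3q + s, 3p + t), the m×n block x of T_{k+1} at (q, p) then fits, and y = μ(x)[s, t].
-- For disjointness, (s, t) is read off the 4×4 corner of y: a line of μ(x) through the middle of
-- its blocks changes value only at block boundaries, so at most once in four cells, whereas every
-- other line changes twice inside each block. The first two rows (columns) of y thus locate the
-- middle rows (columns) of the blocks, and with them s (t).

open import Defs
open import Data.Nat using (ℕ; _≤_)
open import Data.Fin using (Fin)
open import Data.Product using (_×_; _,_; ∃; ∃-syntax)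
open import Relation.Nullary using (¬_)
open import Relation.Binary.PropositionalEquality using (_≡_; _≢_)
open import Function.Bundles using (_⇔_)

open import Data.Bool using (Bool; true; false; not; _∧_; _∨_; _xor_)
open import Data.Nat using (zero; suc; _+_; _*_; _<_; z≤n; s≤s; z<s; s<s; >-nonZero)
open import Data.Nat.Properties
  using ( +-assoc; +-comm; +-suc; +-identityʳ; *-comm; *-distribʳ-+; *-cancelʳ-<
        ; ≤-reflexive; ≤-trans; ≤-<-trans; <-≤-trans; ≤-pred; m≤m+n; m≤n+m; m≤m*n; m<m*n
        ; +-mono-≤; +-monoˡ-≤; +-monoʳ-≤; +-monoʳ-<; module ≤-Reasoning )
open import Data.Nat.DivMod using (_divMod_; result)
open import Data.Fin using (toℕ; fromℕ; fromℕ<; _≟_)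
open import Data.Fin.Patterns using (0F; 1F; 2F)
open import Data.Fin.Properties using (toℕ<n; toℕ-fromℕ; toℕ-fromℕ<; all?)
open import Data.Vec using (Vec; []; _∷_; _++_; lookup; tabulate; concat; map)
open import Data.Vec.Properties using (lookup∘tabulate; tabulate∘lookup; tabulate-cong)
open import Data.Maybe as Maybe using (just; nothing; fromMaybe)
open import Data.Product using (proj₁; proj₂)
open import Data.Product.Properties using (≡-dec)
open import Relation.Nullary using (Dec; map′; _×-dec_)
open import Relation.Nullary.Decidable using (from-yes)
open import Relation.Unary using (Pred; Decidable)
open import Relation.Binary.PropositionalEquality
  using (refl; sym; trans; cong; cong₂; subst₂; module ≡-Reasoning)
open import Function.Bundles using (mk⇔)

private
  variable
    A B : Set
    m n M N M′ N′ r c r′ c′ : ℕ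

at-lookup : (v : Vec A n) (i : Fin n) → at v (toℕ i) ≡ just (lookup v i)
at-lookup (x ∷ v) Fin.zero    = refl
at-lookup (x ∷ v) (Fin.suc i) = at-lookup v i

at≡just⇒< : (v : Vec A n) (a : ℕ) {x : A} → at v a ≡ just x → a < n
at≡just⇒< (y ∷ v) zero    _  = z<s
at≡just⇒< (y ∷ v) (suc a) eq = s<s (at≡just⇒< v a eq)

<⇒at≡just : (v : Vec A n) (a : ℕ) → a < n → ∃[ x ] at v a ≡ just x
<⇒at≡just (x ∷ v) zero    _         = x , refl
<⇒at≡just (x ∷ v) (suc a) (s≤s a<n) = <⇒at≡just v a a<n

at-++ˡ : {k : ℕ} (xs : Vec A k) (ys : Vec A n) (i : Fin k) → at (xs ++ ys) (toℕ i) ≡ just (lookup xs i)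
at-++ˡ (x ∷ xs) ys Fin.zero    = refl
at-++ˡ (x ∷ xs) ys (Fin.suc i) = at-++ˡ xs ys i

at-++ʳ : {k : ℕ} (xs : Vec A k) (ys : Vec A n) (a : ℕ) → at (xs ++ ys) (k + a) ≡ at ys a
at-++ʳ []       ys a = refl
at-++ʳ (x ∷ xs) ys a = at-++ʳ xs ys a

at-concat : {k : ℕ} (xss : Vec (Vec A k) n) (q : ℕ) (s : Fin k) →
            at (concat xss) (q * k + toℕ s) ≡ Maybe.map (λ xs → lookup xs s) (at xss q)
at-concat []         q       s = refl
at-concat (xs ∷ xss) zero    s = at-++ˡ xs (concat xss) s
at-concat {k = k} (xs ∷ xss) (suc q) s = begin
  at (xs ++ concat xss) (k + q * k + toℕ s)   ≡⟨ cong (at (xs ++ concat xss)) (+-assoc k (q * k) (toℕ s)) ⟩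
  at (xs ++ concat xss) (k + (q * k + toℕ s)) ≡⟨ at-++ʳ xs (concat xss) (q * k + toℕ s) ⟩
  at (concat xss) (q * k + toℕ s)             ≡⟨ at-concat xss q s ⟩
  Maybe.map (λ xs → lookup xs s) (at xss q)   ∎
  where open ≡-Reasoning

at-map : (f : A → B) (v : Vec A n) (a : ℕ) → at (map f v) a ≡ Maybe.map f (at v a)
at-map f []      a       = refl
at-map f (x ∷ v) zero    = refl
at-map f (x ∷ v) (suc a) = at-map f v a

atM-lookup : (x : Mat m n) (i : Fin m) (j : Fin n) → atM x (toℕ i) (toℕ j) ≡ just (lookup (lookup x i) j)
atM-lookup x i j rewrite at-lookup x i = at-lookup (lookup x i) j

atM≡just⇒< : (S : Mat M N) (a b : ℕ) {x : Bool} → atM S a b ≡ just x → a < M × b < N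
atM≡just⇒< S a b eq with at S a in row≡ | eq
... | just row | entry≡ = at≡just⇒< S a row≡ , at≡just⇒< row b entry≡

<⇒atM≡just : (S : Mat M N) (a b : ℕ) → a < M → b < N → ∃[ x ] atM S a b ≡ just x
<⇒atM≡just S a b a<M b<N with <⇒at≡just S a a<M
... | row , row≡ rewrite row≡ = <⇒at≡just row b b<N

blockEntry : Bool → Fin 3 → Fin 3 → Bool
blockEntry b s t = lookup (blockRow b s) t

atM-μ : (S : Mat M N) (q p : ℕ) (s t : Fin 3) →
        atM (μ S) (q * 3 + toℕ s) (p * 3 + toℕ t) ≡ Maybe.map (λ b → blockEntry b s t) (atM S q p)
atM-μ S q p s t
  rewrite at-concat (map (λ row → tabulate (λ i → concat (map (λ b → blockRow b i) row))) S) q s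
        | at-map (λ row → tabulate (λ i → concat (map (λ b → blockRow b i) row))) S q
  with at S q
... | nothing  = refl
... | just row
  rewrite lookup∘tabulate (λ i → concat (map (λ b → blockRow b i) row)) s
        | at-concat (map (λ b → blockRow b s) row) p t
        | at-map (λ b → blockRow b s) row p
  with at row p
... | nothing = refl
... | just b  = refl

blockPosition : (a : ℕ) → ∃[ q ] ∃[ s ] a ≡ q * 3 + toℕ {3} s
blockPosition a with a divMod 3
... | result q s a≡ = q , s , trans a≡ (+-comm (toℕ s) (q * 3))

block-shift : (r q : ℕ) (s : Fin 3) → r * 3 + (q * 3 + toℕ s) ≡ (r + q) * 3 + toℕ s
block-shift r q s =
  trans (sym (+-assoc (r * 3) (q * 3) (toℕ s))) (cong (_+ toℕ s) (sym (*-distribʳ-+ 3 r q)))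

block-< : {q : ℕ} (s : Fin 3) → q * 3 + toℕ s < m * 3 → q < m
block-< {m} {q} s q3+s<m3 = *-cancelʳ-< 3 q m (≤-<-trans (m≤m+n (q * 3) (toℕ s)) q3+s<m3)

offset-fits : (s : Fin 3) → toℕ s + suc m ≤ suc m * 3
offset-fits {m} s = ≤-trans (≤-reflexive (+-suc (toℕ s) m)) (+-mono-≤ (toℕ<n s) (m≤m*n m 3))

+-<-fits : {a : ℕ} → a < m → r + m ≤ M → r + a < M
+-<-fits {r = r} a<m r+m≤M = <-≤-trans (+-monoʳ-< r a<m) r+m≤M

IsSub⇒atM≡ : {S : Mat M N} {x : Mat m n} → IsSub S r c x →
             {a b : ℕ} → a < m → b < n → atM S (r + a) (c + b) ≡ atM x a b
IsSub⇒atM≡ {r = r} {c = c} {S = S} {x = x} x⊑S a<m b<n =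
  subst₂ (λ a b → atM S (r + a) (c + b) ≡ atM x a b) (toℕ-fromℕ< a<m) (toℕ-fromℕ< b<n)
    (trans (x⊑S i j) (sym (atM-lookup x i j)))
  where
  i = fromℕ< a<m
  j = fromℕ< b<n

atM≡⇒IsSub : {S : Mat M N} {x : Mat m n} →
             ({a b : ℕ} → a < m → b < n → atM S (r + a) (c + b) ≡ atM x a b) → IsSub S r c x
atM≡⇒IsSub {x = x} entries i j = trans (entries (toℕ<n i) (toℕ<n j)) (atM-lookup x i j)

IsSub⇒fits : {S : Mat M N} {x : Mat (suc m) (suc n)} → IsSub S r c x → r + suc m ≤ M × c + suc n ≤ N
IsSub⇒fits {m = m} {n = n} {r = r} {c = c} {S = S} x⊑S
  with atM≡just⇒< S _ _ (x⊑S (fromℕ m) (fromℕ n))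
... | last-row< , last-column<
  rewrite toℕ-fromℕ m | toℕ-fromℕ n | +-suc r m | +-suc c n = last-row< , last-column<

IsSub-trans : {S : Mat M N} {x : Mat M′ N′} {y : Mat m n} →
              IsSub S r c x → IsSub x r′ c′ y → IsSub S (r + r′) (c + c′) y
IsSub-trans {r = r} {c = c} {r′ = r′} {c′ = c′} {S = S} {x = x} {y = y} x⊑S y⊑x i j = begin
  atM S (r + r′ + toℕ i) (c + c′ + toℕ j)
    ≡⟨ cong₂ (atM S) (+-assoc r r′ (toℕ i)) (+-assoc c c′ (toℕ j)) ⟩
  atM S (r + (r′ + toℕ i)) (c + (c′ + toℕ j))
    ≡⟨ IsSub⇒atM≡ {S = S} {x = x} x⊑S row< column< ⟩
  atM x (r′ + toℕ i) (c′ + toℕ j)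
    ≡⟨ y⊑x i j ⟩
  just (lookup (lookup y i) j)
    ∎
  where
  open ≡-Reasoning
  row<×column< = atM≡just⇒< x _ _ (y⊑x i j)
  row<         = proj₁ row<×column<
  column<      = proj₂ row<×column<

IsSub-restrict : {S : Mat M N} {x : Mat M′ N′} {y : Mat m n} →
                 IsSub S r c x → IsSub S (r + r′) (c + c′) y → r′ + m ≤ M′ → c′ + n ≤ N′ →
                 IsSub x r′ c′ y
IsSub-restrict {r = r} {c = c} {r′ = r′} {c′ = c′} {S = S} {x = x} {y = y}
               x⊑S y⊑S row-fits column-fits =
  atM≡⇒IsSub {S = x} {x = y} λ {a} {b} a<m b<n → begin
    atM x (r′ + a) (c′ + b)
      ≡⟨ IsSub⇒atM≡ {S = S} {x = x} x⊑S (+-<-fits a<m row-fits) (+-<-fits b<n column-fits) ⟨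
    atM S (r + (r′ + a)) (c + (c′ + b))
      ≡⟨ cong₂ (atM S) (+-assoc r r′ a) (+-assoc c c′ b) ⟨
    atM S (r + r′ + a) (c + c′ + b)
      ≡⟨ IsSub⇒atM≡ {S = S} {x = y} y⊑S a<m b<n ⟩
    atM y a b
      ∎
  where open ≡-Reasoning

-- Entries outside S are padded with false.
window : (m n : ℕ) → Mat M N → ℕ → ℕ → Mat m n
window m n S r c = tabulate λ i → tabulate λ j → fromMaybe false (atM S (r + toℕ i) (c + toℕ j))

lookup-window : (S : Mat M N) (i : Fin m) (j : Fin n) →
                lookup (lookup (window m n S r c) i) j ≡ fromMaybe false (atM S (r + toℕ i) (c + toℕ j))
lookup-window S i j = trans (cong (λ row → lookup row j) (lookup∘tabulate _ i)) (lookup∘tabulate _ j)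

IsSub-window : (S : Mat M N) → r + m ≤ M → c + n ≤ N → IsSub S r c (window m n S r c)
IsSub-window {r = r} {c = c} S row-fits column-fits i j
  with atM S (r + toℕ i) (c + toℕ j) in entry≡
     | <⇒atM≡just S (r + toℕ i) (c + toℕ j) (+-<-fits (toℕ<n i) row-fits) (+-<-fits (toℕ<n j) column-fits)
... | nothing | _ , ()
... | just _  | _ = cong just (trans (sym (cong (fromMaybe false) entry≡)) (sym (lookup-window S i j)))

IsSub⇒≡window : {S : Mat M N} {x : Mat m n} → IsSub S r c x → x ≡ window m n S r c
IsSub⇒≡window {x = x} x⊑S =
  trans (sym (tabulate∘lookup x)) (tabulate-cong λ i →
    trans (sym (tabulate∘lookup (lookup x i))) (tabulate-cong λ j →
      cong (fromMaybe false) (sym (x⊑S i j))))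

μ-IsSub : {S : Mat M N} {x : Mat m n} → IsSub S r c x → IsSub (μ S) (r * 3) (c * 3) (μ x)
μ-IsSub {m = m} {n = n} {r = r} {c = c} {S = S} {x = x} x⊑S = atM≡⇒IsSub {S = μ S} {x = μ x} entries
  where
  open ≡-Reasoning
  entries : {a b : ℕ} → a < m * 3 → b < n * 3 → atM (μ S) (r * 3 + a) (c * 3 + b) ≡ atM (μ x) a b
  entries {a} {b} a< b< with blockPosition a | blockPosition b
  ... | q , s , refl | p , t , refl = begin
    atM (μ S) (r * 3 + (q * 3 + toℕ s)) (c * 3 + (p * 3 + toℕ t))
      ≡⟨ cong₂ (atM (μ S)) (block-shift r q s) (block-shift c p t) ⟩
    atM (μ S) ((r + q) * 3 + toℕ s) ((c + p) * 3 + toℕ t)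
      ≡⟨ atM-μ S (r + q) (c + p) s t ⟩
    Maybe.map (λ b → blockEntry b s t) (atM S (r + q) (c + p))
      ≡⟨ cong (Maybe.map _) (IsSub⇒atM≡ {S = S} {x = x} x⊑S (block-< s a<) (block-< t b<)) ⟩
    Maybe.map (λ b → blockEntry b s t) (atM x q p)
      ≡⟨ atM-μ x q p s t ⟨
    atM (μ x) (q * 3 + toℕ s) (p * 3 + toℕ t)
      ∎

μ-desubstitute : {S : Mat M N} {y : Mat (suc m) (suc n)} {q p : ℕ} (s t : Fin 3) →
                 IsSub (μ S) (q * 3 + toℕ s) (p * 3 + toℕ t) y → q + suc m ≤ M → p + suc n ≤ N →
                 ∃[ x ] IsSub S q p x × IsSub (μ x) (toℕ s) (toℕ t) y
μ-desubstitute {m = m} {n = n} {S = S} {y = y} {q} {p} s t y⊑μS row-fits column-fits =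
  x , x⊑S , IsSub-restrict {S = μ S} {x = μ x} {y = y} (μ-IsSub {S = S} {x = x} x⊑S) y⊑μS
                           (offset-fits s) (offset-fits t)
  where
  x   = window (suc m) (suc n) S q p
  x⊑S = IsSub-window S row-fits column-fits

T-centre : (k : ℕ) → IsSub (T (suc k)) (side k) (side k) (T k)
T-centre zero    0F 0F = refl
T-centre (suc k) = μ-IsSub {S = T (suc k)} {x = T k} (T-centre k)

k<side : (k : ℕ) → k < side k
k<side zero    = z<s
k<side (suc k) = begin-strict
  suc k      ≤⟨ k<side k ⟩
  side k     <⟨ m<m*n (side k) 3 {{>-nonZero (≤-<-trans z≤n (k<side k))}} (s<s z<s) ⟩
  side k * 3 ∎
  where open ≤-Reasoning

quotient-fits : {S q : ℕ} (s : Fin 3) → S + r ≡ q * 3 + toℕ s → r + m ≤ S → S + q + m ≤ S * 3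
quotient-fits {r = r} {m = m} {S} {q} s S+r≡ r+m≤S = begin
  S + q + m       ≤⟨ +-monoˡ-≤ m (+-monoʳ-≤ S q≤S+r) ⟩
  S + (S + r) + m ≡⟨ cong (_+ m) (+-assoc S S r) ⟨
  S + S + r + m   ≡⟨ +-assoc (S + S) r m ⟩
  S + S + (r + m) ≤⟨ +-monoʳ-≤ (S + S) r+m≤S ⟩
  S + S + S       ≡⟨ +-assoc S S S ⟩
  S + (S + S)     ≡⟨ cong (λ S′ → S + (S + S′)) (+-identityʳ S) ⟨
  3 * S           ≡⟨ *-comm 3 S ⟩
  S * 3           ∎
  where
  open ≤-Reasoning
  q≤S+r : q ≤ S + r
  q≤S+r = ≤-trans (m≤m*n q 3) (≤-trans (m≤m+n (q * 3) (toℕ s)) (≤-reflexive (sym S+r≡)))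

InPij⇒InPT : (y : Mat m n) {i j : Fin 3} → InPij i j y → InPT y
InPij⇒InPT y {i} {j} (x , (k , r , c , x⊑Tk) , y⊑μx) =
  suc k , r * 3 + toℕ i , c * 3 + toℕ j ,
  IsSub-trans {S = T (suc k)} {x = μ x} {y = y} (μ-IsSub {S = T k} {x = x} x⊑Tk) y⊑μx

InPT⇒InPij : (y : Mat (suc m) (suc n)) → InPT y → ∃[ i ] ∃[ j ] InPij i j y
InPT⇒InPij y (k , r , c , y⊑Tk) with blockPosition (side k + r) | blockPosition (side k + c)
... | q , s , S+r≡ | p , t , S+c≡ =
  let x , x⊑T , y⊑μx = μ-desubstitute {S = T (suc k)} {y = y} s t y⊑μT row-fits column-fits
  in  s , t , x , (suc k , S + q , S + p , x⊑T) , y⊑μx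
  where
  S = side k
  y⊑T₂ : IsSub (T (suc (suc k))) (S * 3 + (S + r)) (S * 3 + (S + c)) y
  y⊑T₂ = IsSub-trans {S = T (suc (suc k))} {x = T (suc k)} {y = y} (T-centre (suc k))
           (IsSub-trans {S = T (suc k)} {x = T k} {y = y} (T-centre k) y⊑Tk)
  y⊑μT : IsSub (μ (T (suc k))) ((S + q) * 3 + toℕ s) ((S + p) * 3 + toℕ t) y
  y⊑μT = subst₂ (λ R C → IsSub (T (suc (suc k))) R C y)
           (trans (cong (S * 3 +_) S+r≡) (block-shift S q s))
           (trans (cong (S * 3 +_) S+c≡) (block-shift S p t))
           y⊑T₂
  row-fits    = quotient-fits s S+r≡ (proj₁ (IsSub⇒fits {S = T k} {x = y} y⊑Tk))
  column-fits = quotient-fits t S+c≡ (proj₂ (IsSub⇒fits {S = T k} {x = y} y⊑Tk))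

InPij-nonempty : (m n : ℕ) (i j : Fin 3) → ∃[ y ] InPij {suc m} {suc n} i j y
InPij-nonempty m n i j = y , x , (k , 0 , 0 , x⊑Tk) , y⊑μx
  where
  k    = m + n
  x    = window (suc m) (suc n) (T k) 0 0
  x⊑Tk = IsSub-window (T k) (≤-trans (s≤s (m≤m+n m n)) (k<side k))
                             (≤-trans (s≤s (m≤n+m n m)) (k<side k))
  y    = window (suc m) (suc n) (μ x) (toℕ i) (toℕ j)
  y⊑μx = IsSub-window (μ x) (offset-fits i) (offset-fits j)

changesAtMostOnce : Bool → Bool → Bool → Bool → Bool
changesAtMostOnce w x y z = not ((w xor x) ∧ (x xor y) ∨ (x xor y) ∧ (y xor z) ∨ (w xor x) ∧ (y xor z))

-- Line u of a window at offset i runs through the middle of its blocks iff i + u ≡ 1 (mod 3).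
phase : Bool → Bool → Fin 3
phase true  _     = 1F
phase false true  = 0F
phase false false = 2F

decode : Mat 4 4 → Fin 3 × Fin 3
decode ((a₀ ∷ a₁ ∷ a₂ ∷ a₃ ∷ []) ∷ (b₀ ∷ b₁ ∷ b₂ ∷ b₃ ∷ []) ∷ (c₀ ∷ c₁ ∷ _) ∷ (d₀ ∷ d₁ ∷ _) ∷ []) =
  phase (changesAtMostOnce a₀ a₁ a₂ a₃) (changesAtMostOnce b₀ b₁ b₂ b₃) ,
  phase (changesAtMostOnce a₀ b₀ c₀ d₀) (changesAtMostOnce a₁ b₁ c₁ d₁)

all-Bool? : ∀ {p} {P : Pred Bool p} → Decidable P → Dec (∀ b → P b)
all-Bool? P? =
  map′ (λ { (Pf , Pt) false → Pf ; (Pf , Pt) true → Pt }) (λ ∀P → ∀P false , ∀P true)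
       (P? false ×-dec P? true)

decode-μ-window : (x : Mat 2 2) (i j : Fin 3) → decode (window 4 4 (μ x) (toℕ i) (toℕ j)) ≡ (i , j)
decode-μ-window ((a ∷ b ∷ []) ∷ (c ∷ d ∷ []) ∷ []) = from-yes
  (all-Bool? λ a → all-Bool? λ b → all-Bool? λ c → all-Bool? λ d → all? λ i → all? λ j →
     ≡-dec _≟_ _≟_
       (decode (window 4 4 (μ ((a ∷ b ∷ []) ∷ (c ∷ d ∷ []) ∷ [])) (toℕ i) (toℕ j)))
       (i , j))
  a b c d

offset : Mat (4 + m) (4 + n) → Fin 3 × Fin 3
offset y = decode (window 4 4 y 0 0)

InPij⇒offset : (y : Mat (4 + m) (4 + n)) {i j : Fin 3} → InPij i j y → offset y ≡ (i , j)
InPij⇒offset {m = m} {n = n} y {i} {j} (x , _ , y⊑μx) = begin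
  decode corner
    ≡⟨ cong decode (IsSub⇒≡window {r = toℕ i} {c = toℕ j} {S = μ x₂} corner⊑μx₂) ⟩
  decode (window 4 4 (μ x₂) (toℕ i) (toℕ j))
    ≡⟨ decode-μ-window x₂ i j ⟩
  (i , j)
    ∎
  where
  open ≡-Reasoning
  x₂     = window 2 2 x 0 0
  corner = window 4 4 y 0 0
  μx₂⊑μx : IsSub (μ x) 0 0 (μ x₂)
  μx₂⊑μx = μ-IsSub {S = x} {x = x₂} (IsSub-window x (s≤s (s≤s z≤n)) (s≤s (s≤s z≤n)))
  corner⊑μx : IsSub (μ x) (toℕ i) (toℕ j) corner
  corner⊑μx = subst₂ (λ r c → IsSub (μ x) r c corner) (+-identityʳ (toℕ i)) (+-identityʳ (toℕ j))
                (IsSub-trans {S = μ x} {x = y} {y = corner} y⊑μx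
                  (IsSub-window y (m≤m+n 4 m) (m≤m+n 4 n)))
  corner⊑μx₂ : IsSub (μ x₂) (toℕ i) (toℕ j) corner
  corner⊑μx₂ = IsSub-restrict {S = μ x} {x = μ x₂} {y = corner} μx₂⊑μx corner⊑μx
                 (+-monoˡ-≤ 4 (≤-pred (toℕ<n i))) (+-monoˡ-≤ 4 (≤-pred (toℕ<n j)))

lemma3 : (m n : ℕ) → 4 ≤ m → 4 ≤ n →
    ((y : Mat m n) → InPT y ⇔ (∃[ i ] ∃[ j ] InPij i j y))
    × ((i j : Fin 3) → ∃[ y ] InPij {m} {n} i j y)
    × ((i j i′ j′ : Fin 3) → (i , j) ≢ (i′ , j′) →
         (y : Mat m n) → ¬ (InPij i j y × InPij i′ j′ y))
lemma3 (suc (suc (suc (suc m)))) (suc (suc (suc (suc n))))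
       (s≤s (s≤s (s≤s (s≤s _)))) (s≤s (s≤s (s≤s (s≤s _)))) =
  (λ y → mk⇔ (InPT⇒InPij y) (λ (_ , _ , y∈Pij) → InPij⇒InPT y y∈Pij)) ,
  InPij-nonempty (3 + m) (3 + n) ,
  λ i j i′ j′ ij≢i′j′ y (y∈Pij , y∈Pi′j′) →
    ij≢i′j′ (trans (sym (InPij⇒offset y y∈Pij)) (InPij⇒offset y y∈Pi′j′))
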